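{- If $G$ is a finite connected graph with $\mathrm{diam}(G)\ge 3$, then $c_H(G)\le c(G)+2$.
   Context: $c(G)$ denotes the usual cop number of $G$ (classical Cops and Robbers with the robber always visible). Hyperopic Cops and Robbers on a finite connected simple graph $G$: one player controls $k$ cops, the other a single robber. The cops first choose starting vertices (several cops may share a vertex), then the robber chooses a starting vertex; afterwards, in each round, each cop moves to an adjacent vertex or stays put, and then the robber moves to an adjacent vertex or stays put. The robber always knows the cops' positions. The robber is invisible to the cops exactly when the robber's vertex is adjacent to the vertex of every cop (a robber on the same vertex as a cop is visible); otherwise the cops see the robber's position. The cops win if after finitely many rounds some cop occupies the robber's vertex, and the cops' strategy must guarantee this with certainty (no chance allowed). The hyperopic cop number $c_H(G)$ is the minimum $k$ for which $k$ cops have a winning strategy. -}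

module Defs where

open import Data.Nat using (ℕ; zero; suc; _≤_; _<_)
open import Data.Fin using (Fin)
open import Data.Fin.Properties using (all?)
open import Data.Product using (Σ; Σ-syntax; ∃; ∃-syntax; _×_; _,_; proj₁; proj₂)
open import Data.Sum using (_⊎_)
open import Data.List using (List; []; _∷_)
open import Data.Maybe using (Maybe; just; nothing)
open import Relation.Nullary using (¬_; Dec; yes; no)
open import Relation.Binary.PropositionalEquality using (_≡_)

record Graph (n : ℕ) : Set₁ where
  field
    Adj   : Fin n → Fin n → Set
    adj?  : (u v : Fin n) → Dec (Adj u v)
    sym   : ∀ {u v} → Adj u v → Adj v u
    irrefl : ∀ {u} → ¬ Adj u u
open Graph public

module _ {n : ℕ} (G : Graph n) where

  data Walk : Fin n → Fin n → ℕ → Set where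
    here : ∀ {u} → Walk u u zero
    step : ∀ {u v w ℓ} → Adj G u v → Walk v w ℓ → Walk u w (suc ℓ)

  Connected : Set
  Connected = ∀ u v → ∃[ ℓ ] Walk u v ℓ

  DiamAtLeast3 : Set
  DiamAtLeast3 = ∃[ u ] ∃[ v ] (∀ ℓ → ℓ ≤ 2 → ¬ Walk u v ℓ)

  module _ (k : ℕ) where
    Config : Set
    Config = Fin k → Fin n

    LegalMove : Config → Config → Set
    LegalMove c c' = ∀ i → c' i ≡ c i ⊎ Adj G (c i) (c' i)

    -- what the cops observe: just r (robber seen) or nothing (robber invisible)
    Observation : Set
    Observation = Config → Fin n → Maybe (Fin n)

    fullObs : Observation
    fullObs c r = just r

    hyperopicObs : Observation
    hyperopicObs c r with all? (λ i → adj? G (c i) r)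
    ... | yes _ = nothing
    ... | no  _ = just r

    -- a deterministic cop strategy: from the current positions and the list of
    -- all observations so far (newest first) choose a legal move
    Strategy : Set
    Strategy = (c : Config) → List (Maybe (Fin n)) → Σ[ c' ∈ Config ] LegalMove c c'

    -- a robber trajectory: r t is the robber's vertex at the start of round t
    RobberWalk : Set
    RobberWalk = Σ[ r ∈ (ℕ → Fin n) ] (∀ t → r (suc t) ≡ r t ⊎ Adj G (r t) (r (suc t)))

    -- the state at the start of round t: cop positions and observations made
    -- at rounds < t (newest first)
    play : Observation → Config → Strategy → (ℕ → Fin n) → ℕ → Config × List (Maybe (Fin n))
    play obs c₀ σ r zero = c₀ , []
    play obs c₀ σ r (suc t) with play obs c₀ σ r t
    ... | c , h = proj₁ (σ c (obs c (r t) ∷ h)) , (obs c (r t) ∷ h)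

    cops : Observation → Config → Strategy → (ℕ → Fin n) → ℕ → Config
    cops obs c₀ σ r t = proj₁ (play obs c₀ σ r t)

    -- capture in round t: a cop is on the robber's vertex at the start of
    -- round t, or a cop moves onto the robber's vertex during round t
    Captured : Observation → Config → Strategy → (ℕ → Fin n) → Set
    Captured obs c₀ σ r = ∃[ t ] ∃[ i ]
      (cops obs c₀ σ r t i ≡ r t ⊎ cops obs c₀ σ r (suc t) i ≡ r t)

    CopsWin : Observation → Set
    CopsWin obs = ∃[ c₀ ] ∃[ σ ] ((ρ : RobberWalk) → Captured obs c₀ σ (proj₁ ρ))

  ClassicalWin : ℕ → Set
  ClassicalWin k = CopsWin k (fullObs k)

  HyperopicWin : ℕ → Set
  HyperopicWin k = CopsWin k (hyperopicObs k)

  IsCopNumber : ℕ → Set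
  IsCopNumber k = ClassicalWin k × (∀ j → j < k → ¬ ClassicalWin j)

  IsHyperopicCopNumber : ℕ → Set
  IsHyperopicCopNumber k = HyperopicWin k × (∀ j → j < k → ¬ HyperopicWin j)

-- Park two extra cops for the whole game on two vertices u, v at distance at
-- least 3.  Then u and v have no common neighbour, so the robber is never
-- adjacent to every cop and is always visible: the hyperopic game degenerates
-- into the classical one, in which the other c cops follow a winning classical
-- strategy.
module Submission where

open import Defs
open import Data.Nat using (ℕ; zero; suc; _≤_; _+_)
open import Data.Nat.Properties using (≤-refl; _≤?_; ≰⇒>)
open import Data.Fin using (Fin; zero; suc; splitAt; _↑ˡ_; _↑ʳ_)
open import Data.Fin.Properties using (all?; splitAt-↑ˡ; splitAt-↑ʳ)
open import Data.Product using (Σ-syntax; _×_; _,_; proj₁; proj₂)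
open import Data.Sum using (_⊎_; inj₁; inj₂; [_,_]′)
open import Data.List using (List; []; _∷_)
open import Data.Maybe using (Maybe; just)
open import Data.Empty using (⊥; ⊥-elim)
open import Relation.Nullary using (¬_; yes; no)
open import Relation.Binary.PropositionalEquality
  using (_≡_; refl; trans; cong; cong₂; subst; module ≡-Reasoning)
  renaming (sym to ≡-sym)

module _ {n} (G : Graph n) where

  NoCommonNeighbour : Fin n → Fin n → Set
  NoCommonNeighbour u v = ∀ {x} → Adj G u x → Adj G v x → ⊥

  distance≥3⇒noCommonNeighbour : ∀ {u v} → (∀ ℓ → ℓ ≤ 2 → ¬ Walk G u v ℓ) →
                                 NoCommonNeighbour u v
  distance≥3⇒noCommonNeighbour far ux vx = far 2 ≤-refl (step ux (step (sym G vx) here))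

  hyperopicObs-visible : ∀ {k} (c : Config G k) i j → NoCommonNeighbour (c i) (c j) →
                         ∀ x → hyperopicObs G k c x ≡ just x
  hyperopicObs-visible c i j apart x with all? (λ l → adj? G (c l) x)
  ... | yes adjacentToAll = ⊥-elim (apart (adjacentToAll i) (adjacentToAll j))
  ... | no _              = refl

  stepToward : (a b : Fin n) → Σ[ b′ ∈ Fin n ] (b′ ≡ a ⊎ Adj G a b′)
  stepToward a b with adj? G a b
  ... | yes ab = b , inj₂ ab
  ... | no _   = a , inj₁ refl

  stepToward-reaches : ∀ {a b} → b ≡ a ⊎ Adj G a b → proj₁ (stepToward a b) ≡ b
  stepToward-reaches {a} {b} legal with adj? G a b
  stepToward-reaches legal    | yes _ = refl
  stepToward-reaches (inj₁ e) | no _  = ≡-sym e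
  stepToward-reaches (inj₂ p) | no ¬p = ⊥-elim (¬p p)

  -- A strategy is only handed the current positions, and without function
  -- extensionality pointwise-equal positions need not give equal moves.  The
  -- c simulating cops therefore recompute the classical positions from the
  -- observation history (replay) and step onto them.
  module WithSentinels {u v} (apart : NoCommonNeighbour u v)
                       {c} (c₀ : Config G c) (σ : Strategy G c) where

    History : Set
    History = List (Maybe (Fin n))

    replay : History → Config G c
    replay []      = c₀
    replay (o ∷ h) = proj₁ (σ (replay h) (o ∷ h))

    sentinel : Fin 2 → Fin n
    sentinel zero    = u
    sentinel (suc _) = v

    formation : History → Fin c ⊎ Fin 2 → Fin n
    formation h = [ replay h , sentinel ]′

    start : Config G (c + 2)
    start i = formation [] (splitAt c i)

    advance : (x : Fin n) → History → Fin c ⊎ Fin 2 →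
              Σ[ x′ ∈ Fin n ] (x′ ≡ x ⊎ Adj G x x′)
    advance x h (inj₁ j) = stepToward x (replay h j)
    advance x h (inj₂ _) = x , inj₁ refl

    σ⁺ : Strategy G (c + 2)
    σ⁺ c′ h = (λ i → proj₁ (advance (c′ i) h (splitAt c i)))
            , (λ i → proj₂ (advance (c′ i) h (splitAt c i)))

    advance-formation : ∀ {o h} s {x} → x ≡ formation h s →
                        proj₁ (advance x (o ∷ h) s) ≡ formation (o ∷ h) s
    advance-formation {o} {h} (inj₁ j) refl =
      stepToward-reaches (proj₂ (σ (replay h) (o ∷ h)) j)
    advance-formation (inj₂ _) x≡sentinel = x≡sentinel

    module _ (r : ℕ → Fin n) where

      classical : ℕ → Config G c × History
      classical = play G c (fullObs G c) c₀ σ r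
      hyperopic : ℕ → Config G (c + 2) × History
      hyperopic = play G (c + 2) (hyperopicObs G (c + 2)) start σ⁺ r

      classical≡replay : ∀ t → proj₁ (classical t) ≡ replay (proj₂ (classical t))
      classical≡replay zero = refl
      classical≡replay (suc t) rewrite classical≡replay t = refl

      hyperopic≡formation : ∀ t i → proj₁ (hyperopic t) i ≡
                                    formation (proj₂ (hyperopic t)) (splitAt c i)
      hyperopic≡formation zero    i = refl
      hyperopic≡formation (suc t) i =
        advance-formation (splitAt c i) (hyperopic≡formation t i)

      sentinel-stays : ∀ t k → proj₁ (hyperopic t) (c ↑ʳ k) ≡ sentinel k
      sentinel-stays t k = trans (hyperopic≡formation t (c ↑ʳ k))
                                 (cong (formation (proj₂ (hyperopic t))) (splitAt-↑ʳ c 2 k))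

      robber-visible : ∀ t → hyperopicObs G (c + 2) (proj₁ (hyperopic t)) (r t) ≡ just (r t)
      robber-visible t =
        hyperopicObs-visible (proj₁ (hyperopic t)) (c ↑ʳ zero) (c ↑ʳ suc zero)
        (λ ux vx → apart (subst (λ w → Adj G w _) (sentinel-stays t zero) ux)
                         (subst (λ w → Adj G w _) (sentinel-stays t (suc zero)) vx))
        (r t)

      sameHistory : ∀ t → proj₂ (hyperopic t) ≡ proj₂ (classical t)
      sameHistory zero    = refl
      sameHistory (suc t) = cong₂ _∷_ (robber-visible t) (sameHistory t)

      simulates : ∀ t j → proj₁ (hyperopic t) (j ↑ˡ 2) ≡ proj₁ (classical t) j
      simulates t j = begin
        proj₁ (hyperopic t) (j ↑ˡ 2)             ≡⟨ hyperopic≡formation t (j ↑ˡ 2) ⟩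
        formation h⁺ (splitAt c (j ↑ˡ 2))        ≡⟨ cong (formation h⁺) (splitAt-↑ˡ c j 2) ⟩
        replay h⁺ j                              ≡⟨ cong (λ h → replay h j) (sameHistory t) ⟩
        replay (proj₂ (classical t)) j           ≡⟨ cong (λ f → f j) (classical≡replay t) ⟨
        proj₁ (classical t) j                    ∎
        where
        open ≡-Reasoning
        h⁺ = proj₂ (hyperopic t)

      capture-transfers : Captured G c (fullObs G c) c₀ σ r →
                          Captured G (c + 2) (hyperopicObs G (c + 2)) start σ⁺ r
      capture-transfers (t , j , inj₁ e) = t , j ↑ˡ 2 , inj₁ (trans (simulates t j) e)
      capture-transfers (t , j , inj₂ e) = t , j ↑ˡ 2 , inj₂ (trans (simulates (suc t) j) e)

  classicalWin⇒hyperopicWin+2 : DiamAtLeast3 G → ∀ c →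
                                ClassicalWin G c → HyperopicWin G (c + 2)
  classicalWin⇒hyperopicWin+2 (u , v , far) c (c₀ , σ , wins) =
    start , σ⁺ , λ ρ → capture-transfers (proj₁ ρ) (wins ρ)
    where open WithSentinels (distance≥3⇒noCommonNeighbour far) c₀ σ

mainTheorem6 : ∀ {n} (G : Graph n) → Connected G → DiamAtLeast3 G →
    ∀ c cH → IsCopNumber G c → IsHyperopicCopNumber G cH → cH ≤ c + 2
mainTheorem6 G _ diam c cH (classicalWins , _) (_ , minimal) with cH ≤? c + 2
... | yes cH≤c+2 = cH≤c+2
... | no  cH≰c+2 = ⊥-elim (minimal (c + 2) (≰⇒> cH≰c+2)
                             (classicalWin⇒hyperopicWin+2 G diam c classicalWins))
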